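{- Let $G=(V,E)$ be a finite simple undirected graph, $\ell:E\to\mathbb{R}_{\ge 0}$ a length function, $s,t\in V$, and $d\in\mathbb{R}$. Let $S_d\subseteq\{0,1\}^E$ be the set of orientations $f$ of $G$ such that in $\vec G^f$ the distance (with respect to $\ell$) from $s$ to $t$ is at most $d$. Then $S_d$ is shattering-extremal.
   Context: Fix an arbitrary reference direction for each edge of $G$. An orientation of $G$ is a function $f\in\{0,1\}^E$; $\vec G^f$ is the digraph obtained by directing each edge $e$ along its reference direction if $f(e)=0$ and against it if $f(e)=1$. The distance from $s$ to $t$ is the minimum length of a directed $s$-$t$ path ($+\infty$ if none exists). For disjoint sets $A,B$ and $g\in\{0,1\}^A$, $h\in\{0,1\}^B$, $g\star h\in\{0,1\}^{A\cup B}$ is the function agreeing with $g$ on $A$ and with $h$ on $B$. For $S\subseteq\{0,1\}^E$ and $Y\subseteq E$: $S$ shatters $Y$ if for every $h\in\{0,1\}^Y$ there exists $g\in\{0,1\}^{E\setminus Y}$ with $g\star h\in S$; $S$ strongly shatters $Y$ if there exists $g\in\{0,1\}^{E\setminus Y}$ such that $g\star h\in S$ for every $h\in\{0,1\}^Y$. $S$ is shattering-extremal if the family of sets shattered by $S$ equals the family of sets strongly shattered by $S$. -}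

module Defs where

open import Level using (Level; suc; _⊔_)
open import Data.Nat using (ℕ)
open import Data.Fin using (Fin)
open import Data.Bool using (Bool; true; false; if_then_else_)
open import Data.Product using (Σ; _×_; _,_; ∃; ∃-syntax; proj₁; proj₂)
open import Data.List using (List; []; _∷_; foldr; map)
open import Data.List.Relation.Unary.Unique.Propositional using (Unique)
open import Relation.Binary.PropositionalEquality using (_≡_; _≢_)
open import Relation.Binary.Structures using (IsTotalOrder)
open import Algebra.Structures using (IsAbelianGroup)
open import Relation.Nullary using (¬_)
open import Function.Bundles using (_⇔_)
open import Data.Sum using (_⊎_)

-- The paper uses ℝ; agda-stdlib has no reals, so we quantify over every
-- totally ordered abelian group (ℝ with + and ≤ is one).  Only addition
-- and the order are used by the statement.

record OrderedAbelianGroup (c ℓ : Level) : Set (suc (c ⊔ ℓ)) where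
  infixl 6 _+_
  infix  4 _≤_
  field
    Carrier        : Set c
    _≤_            : Carrier → Carrier → Set ℓ
    _+_            : Carrier → Carrier → Carrier
    0#             : Carrier
    -_             : Carrier → Carrier
    isAbelianGroup : IsAbelianGroup _≡_ _+_ 0# -_
    isTotalOrder   : IsTotalOrder _≡_ _≤_
    +-mono-≤       : ∀ {x y} z → x ≤ y → x + z ≤ y + z

-- Finite simple graphs: vertices Fin n, edges Fin m, each edge given
-- with its reference direction (tail , head).

record SimpleGraph (n m : ℕ) : Set where
  field
    ends     : Fin m → Fin n × Fin n
    loopless : ∀ e → proj₁ (ends e) ≢ proj₂ (ends e)
    simple   : ∀ e e′ → (ends e ≡ ends e′ ⊎ (proj₁ (ends e) ≡ proj₂ (ends e′) × proj₂ (ends e) ≡ proj₁ (ends e′))) → e ≡ e′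

-- An orientation f : {0,1}^E, with 0 = false, 1 = true.
Orientation : ℕ → Set
Orientation m = Fin m → Bool

module _ {n m : ℕ} (G : SimpleGraph n m) where
  open SimpleGraph G

  Arc : Orientation m → Fin m → Fin n → Fin n → Set
  Arc f e u v with f e
  ... | false = ends e ≡ (u , v)
  ... | true  = ends e ≡ (v , u)

  data Walk (f : Orientation m) : Fin n → Fin n → Set where
    [] : ∀ {u} → Walk f u u
    step : ∀ {u v w} (e : Fin m) → Arc f e u v → Walk f v w → Walk f u w

  walkEdges : ∀ {f u v} → Walk f u v → List (Fin m)
  walkEdges []             = []
  walkEdges (step e _ w)   = e ∷ walkEdges w

  walkVertices : ∀ {f u v} → Walk f u v → List (Fin n)
  walkVertices {u = u} []           = u ∷ []
  walkVertices {u = u} (step e _ w) = u ∷ walkVertices w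

  IsPath : ∀ {f u v} → Walk f u v → Set
  IsPath w = Unique (walkVertices w)

  module _ {c ℓ′} (R : OrderedAbelianGroup c ℓ′) where
    open OrderedAbelianGroup R

    walkLength : (Fin m → Carrier) → ∀ {f u v} → Walk f u v → Carrier
    walkLength len w = foldr _+_ 0# (map len (walkEdges w))

    -- dist_{G^f}(s,t) ≤ d  (the distance being the minimum length of a
    -- directed s-t path, +∞ if none): some directed s-t path has length ≤ d.
    DistAtMost : (Fin m → Carrier) → Orientation m → Fin n → Fin n → Carrier → Set ℓ′
    DistAtMost len f s t d = ∃[ w ] (IsPath {f} {s} {t} w × walkLength len w ≤ d)

-- A subset Y ⊆ E is given by its indicator Y : Fin m → Bool.
-- Functions on E∖Y and on Y are represented by total functions
-- Fin m → Bool of which only the values off Y (resp. on Y) are used;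
-- g ⋆[ Y ] h agrees with h on Y and with g on E∖Y.

_⋆[_]_ : ∀ {m} → (Fin m → Bool) → (Fin m → Bool) → (Fin m → Bool) → (Fin m → Bool)
(g ⋆[ Y ] h) e = if Y e then h e else g e

module _ {m : ℕ} {ℓ : Level} (S : Orientation m → Set ℓ) where

  Shatters : (Fin m → Bool) → Set ℓ
  Shatters Y = ∀ (h : Fin m → Bool) → ∃[ g ] S (g ⋆[ Y ] h)

  StronglyShatters : (Fin m → Bool) → Set ℓ
  StronglyShatters Y = ∃[ g ] ∀ (h : Fin m → Bool) → S (g ⋆[ Y ] h)

  ShatteringExtremal : Set ℓ
  ShatteringExtremal = ∀ (Y : Fin m → Bool) → Shatters Y ⇔ StronglyShatters Y

module Submission where

-- Let S be the set of orientations in which some directed s-t path has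
-- length ≤ d, and let Y be a set of edges shattered by S.  Write ρ(v) for
-- the length of a shortest undirected v-t route in G - Y (∞ if none).
-- Orient every edge of Y away from t, i.e. from its endpoint of smaller ρ
-- to the one of larger ρ.  By shattering, some orientation agreeing with
-- this on Y has a directed s-t path P of length ≤ d.  Walking P backwards
-- from t, every Y-edge u → w satisfies ρ(u) ≤ ρ(w), so it can be replaced
-- by a shortest route from u; since lengths are nonnegative, this yields
-- an undirected s-t route in G - Y of length ≤ d, which we make simple.
-- Orienting its edges along it (and the rest of E ∖ Y arbitrarily) gives
-- g with g ⋆ h ∈ S for every h, i.e. Y is strongly shattered.
--
-- Because the length domain is only a totally ordered group, ρ is computed
-- by a Bellman-Ford recursion; it is exact on simple routes, which have
-- fewer than n steps by the pigeonhole principle for duplicate-free lists.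

open import Defs
open import Level using (Level; Lift)
open import Data.Nat as ℕ using (ℕ; zero; suc; z≤n; s≤s)
open import Data.Nat.Properties using (≮⇒≥; <⇒≤)
open import Data.Fin as Fin using (Fin; zero; suc; _≟_)
open import Data.Fin.Properties using (pigeonhole)
open import Data.Bool using (Bool; true; false)
open import Data.Bool.Properties using () renaming (_≟_ to _≟ᵇ_)
open import Data.Empty using (⊥; ⊥-elim)
open import Data.Unit using (⊤; tt)
open import Data.Maybe as Maybe using (Maybe; just; nothing)
open import Data.Product using (Σ; _×_; _,_; ∃₂; proj₁; proj₂)
open import Data.Product.Properties using (≡-dec)
open import Data.Sum using (_⊎_; inj₁; inj₂)
open import Data.List using (List; []; _∷_; length; lookup; foldr; map; allFin; cartesianProduct)
open import Data.List.Membership.Propositional using (_∈_; _∉_)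
open import Data.List.Membership.Propositional.Properties
  using (∈-lookup; ∈-map⁺; ∈-allFin; ∈-cartesianProduct⁺)
open import Data.List.Relation.Unary.Any using (here; there; any?)
import Data.List.Relation.Unary.All as All
open import Data.List.Relation.Unary.All using (All; [])
open import Data.List.Relation.Unary.All.Properties using (¬Any⇒All¬)
open import Data.List.Relation.Unary.AllPairs using ([]; _∷_)
open import Data.List.Relation.Unary.Unique.Propositional using (Unique)
open import Relation.Binary.PropositionalEquality using (_≡_; _≢_; refl; sym; trans; cong; subst)
open import Relation.Nullary using (Dec; yes; no)
open import Relation.Nullary.Decidable using (_⊎-dec_)
open import Relation.Binary.Structures using (IsTotalOrder)
open import Algebra.Structures using (IsAbelianGroup)
open import Function.Bundles using (mk⇔)

unique-lookup : ∀ {a} {A : Set a} {xs : List A} → Unique xs →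
                ∀ {i j} → i Fin.< j → lookup xs i ≢ lookup xs j
unique-lookup (x∉xs ∷ _) {zero}  {suc j} _           = All.lookup x∉xs (∈-lookup j)
unique-lookup (_ ∷ uniq) {suc i} {suc j} (ℕ.s≤s i<j) = unique-lookup uniq i<j

unique-length : ∀ {n} (xs : List (Fin n)) → Unique xs → length xs ℕ.≤ n
unique-length xs uniq = ≮⇒≥ λ n<len →
  let (i , j , i<j , same) = pigeonhole n<len (lookup xs) in unique-lookup uniq i<j same

strongly⇒shatters : ∀ {m ℓ} (S : Orientation m → Set ℓ) (Y : Fin m → Bool) →
                    StronglyShatters S Y → Shatters S Y
strongly⇒shatters S Y (g , all) h = g , all h

⋆-on : ∀ {m} {Y : Fin m → Bool} (g h : Fin m → Bool) {e} → Y e ≡ true → (g ⋆[ Y ] h) e ≡ h e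
⋆-on g h onY rewrite onY = refl

⋆-off : ∀ {m} {Y : Fin m → Bool} (g h : Fin m → Bool) {e} → Y e ≡ false → (g ⋆[ Y ] h) e ≡ g e
⋆-off g h offY rewrite offY = refl

module OrderFacts {c ℓ} (R : OrderedAbelianGroup c ℓ) where
  open OrderedAbelianGroup R
  open IsTotalOrder isTotalOrder public using (total) renaming (trans to ≤-trans)
  open IsAbelianGroup isAbelianGroup using (comm; identityˡ)

  ≤-refl : ∀ {x} → x ≤ x
  ≤-refl = IsTotalOrder.reflexive isTotalOrder refl

  +-monoʳ-≤ : ∀ a {x y} → x ≤ y → a + x ≤ a + y
  +-monoʳ-≤ a {x} {y} x≤y rewrite comm a x | comm a y = +-mono-≤ a x≤y

  ≤-+ˡ : ∀ {a} x → 0# ≤ a → x ≤ a + x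
  ≤-+ˡ {a} x 0≤a = subst (_≤ a + x) (identityˡ x) (+-mono-≤ x 0≤a)

module Routes {c ℓ} (R : OrderedAbelianGroup c ℓ) {n m : ℕ} (G : SimpleGraph n m)
              (len : Fin m → OrderedAbelianGroup.Carrier R)
              (nonneg : ∀ e → OrderedAbelianGroup._≤_ R (OrderedAbelianGroup.0# R) (len e))
              (Y : Fin m → Bool) (t : Fin n) where
  open OrderedAbelianGroup R
  open OrderFacts R
  open SimpleGraph G

  Link : Fin m → Fin n → Fin n → Set
  Link e u v = ends e ≡ (u , v) ⊎ ends e ≡ (v , u)

  link? : ∀ e u v → Dec (Link e u v)
  link? e u v = ≡-dec _≟_ _≟_ (ends e) (u , v) ⊎-dec ≡-dec _≟_ _≟_ (ends e) (v , u)

  direction : ∀ {e u v} → Link e u v → Bool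
  direction (inj₁ _) = false
  direction (inj₂ _) = true

  arc-link : ∀ f e {u v} → Arc G f e u v → Link e u v
  arc-link f e arc with f e
  ... | false = inj₁ arc
  ... | true  = inj₂ arc

  link-arc : ∀ f e {u v} (lk : Link e u v) → f e ≡ direction lk → Arc G f e u v
  link-arc f e (inj₁ eq) fe rewrite fe = eq
  link-arc f e (inj₂ eq) fe rewrite fe = eq

  data Route : Fin n → Set where
    done : Route t
    step : ∀ {u v} (e : Fin m) → Y e ≡ false → Link e u v → Route v → Route u

  edges : ∀ {u} → Route u → List (Fin m)
  edges done           = []
  edges (step e _ _ r) = e ∷ edges r

  vertices later : ∀ {u} → Route u → List (Fin n)
  vertices {u} r = u ∷ later r
  later done           = []
  later (step _ _ _ r) = vertices r

  steps : ∀ {u} → Route u → ℕ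
  steps done           = zero
  steps (step _ _ _ r) = suc (steps r)

  weight : ∀ {u} → Route u → Carrier
  weight r = foldr _+_ 0# (map len (edges r))

  Simple : ∀ {u} → Route u → Set
  Simple r = Unique (vertices r)

  suffix : ∀ {u x} (r : Route u) → x ∈ vertices r →
           Σ (Route x) λ r′ → weight r′ ≤ weight r × (Simple r → Simple r′)
  suffix r (here refl) = r , ≤-refl , λ simple → simple
  suffix (step e _ _ r) (there x∈r) =
    let (r′ , r′≤r , keep) = suffix r x∈r
    in r′ , ≤-trans r′≤r (≤-+ˡ _ (nonneg e)) , λ { (_ ∷ simple) → keep simple }

  -- Every route can be shortened to a simple one: if the first vertex
  -- reappears in the shortened tail, jump to that occurrence.
  shortcut : ∀ {u} (r : Route u) → Σ (Route u) λ r′ → Simple r′ × weight r′ ≤ weight r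
  shortcut done = done , ([] ∷ []) , ≤-refl
  shortcut {u} (step e free lk r) with shortcut r
  ... | r′ , simple , r′≤r with any? (u ≟_) (vertices r′)
  ...   | yes u∈r′ = let (r″ , r″≤r′ , keep) = suffix r′ u∈r′
                     in r″ , keep simple , ≤-trans r″≤r′ (≤-trans r′≤r (≤-+ˡ _ (nonneg e)))
  ...   | no u∉r′  = step e free lk r′ , (¬Any⇒All¬ _ u∉r′ ∷ simple) , +-monoʳ-≤ (len e) r′≤r

  length-vertices : ∀ {u} (r : Route u) → length (vertices r) ≡ suc (steps r)
  length-vertices done           = refl
  length-vertices (step _ _ _ r) = cong suc (length-vertices r)

  simple-steps : ∀ {u} (r : Route u) → Simple r → steps r ℕ.< n
  simple-steps r simple = subst (ℕ._≤ n) (length-vertices r) (unique-length (vertices r) simple)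

  -- An optional route (nothing standing for "no route", i.e. distance ∞)
  -- of weight at most x.
  Within : ∀ {v} → Maybe (Route v) → Carrier → Set ℓ
  Within nothing  x = Lift ℓ ⊥
  Within (just r) x = weight r ≤ x

  fromWithin : ∀ {v} (mr : Maybe (Route v)) {x} → Within mr x → Σ (Route v) λ r → weight r ≤ x
  fromWithin (just r) r≤x = r , r≤x

  within-weaken : ∀ {v} (mr : Maybe (Route v)) {x y} → Within mr x → x ≤ y → Within mr y
  within-weaken (just r) r≤x x≤y = ≤-trans r≤x x≤y

  lighter : ∀ {v} → Maybe (Route v) → Maybe (Route v) → Maybe (Route v)
  lighter nothing  b        = b
  lighter (just r) nothing  = just r
  lighter (just r) (just r′) with total (weight r) (weight r′)
  ... | inj₁ _ = just r
  ... | inj₂ _ = just r′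

  lighter-left : ∀ {v} (a b : Maybe (Route v)) {x} → Within a x → Within (lighter a b) x
  lighter-left (just r) nothing   r≤x = r≤x
  lighter-left (just r) (just r′) r≤x with total (weight r) (weight r′)
  ... | inj₁ _    = r≤x
  ... | inj₂ r′≤r = ≤-trans r′≤r r≤x

  lighter-right : ∀ {v} (a b : Maybe (Route v)) {x} → Within b x → Within (lighter a b) x
  lighter-right nothing  b         b≤x  = b≤x
  lighter-right (just r) (just r′) r′≤x with total (weight r) (weight r′)
  ... | inj₁ r≤r′ = ≤-trans r≤r′ r′≤x
  ... | inj₂ _    = r′≤x

  lightest : ∀ {v} → List (Maybe (Route v)) → Maybe (Route v)
  lightest = foldr lighter nothing

  lightest-within : ∀ {v} (as : List (Maybe (Route v))) {a x} → a ∈ as → Within a x → Within (lightest as) x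
  lightest-within (a ∷ as) (here refl)  a≤x = lighter-left a (lightest as) a≤x
  lightest-within (b ∷ as) (there a∈as) a≤x = lighter-right b (lightest as) (lightest-within as a∈as a≤x)

  -- Bellman-Ford: best k v is a lightest route from v with at most k steps;
  -- the candidates for k + 1 steps extend best k w across an edge {v, w}.
  best : ℕ → (v : Fin n) → Maybe (Route v)
  candidates : ℕ → (v : Fin n) → List (Maybe (Route v))
  extendAcross : ℕ → (v : Fin n) → Fin m × Fin n → Maybe (Route v)

  best zero v with v ≟ t
  ... | yes refl = just done
  ... | no _     = nothing
  best (suc k) v = lightest (candidates k v)

  candidates k v = best k v ∷ map (extendAcross k v) (cartesianProduct (allFin m) (allFin n))

  extendAcross k v (e , w) with Y e ≟ᵇ false | link? e v w
  ... | yes free | yes lk = Maybe.map (step e free lk) (best k w)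
  ... | _        | _      = nothing

  step-within : ∀ {e u v} (free : Y e ≡ false) (lk : Link e u v) (mr : Maybe (Route v)) {x} →
                Within mr x → Within (Maybe.map (step e free lk) mr) (len e + x)
  step-within {e} free lk (just r) r≤x = +-monoʳ-≤ (len e) r≤x

  extendAcross-within : ∀ k {e v w x} → Y e ≡ false → Link e v w →
                        Within (best k w) x → Within (extendAcross k v (e , w)) (len e + x)
  extendAcross-within k {e} {v} {w} free lk w≤x with Y e ≟ᵇ false | link? e v w
  ... | yes free′ | yes lk′ = step-within free′ lk′ (best k w) w≤x
  ... | yes _     | no ¬lk  = ⊥-elim (¬lk lk)
  ... | no ¬free  | _       = ⊥-elim (¬free free)

  best-complete : ∀ k {v} (r : Route v) → steps r ℕ.≤ k → Within (best k v) (weight r)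
  best-complete zero done _ with t ≟ t
  ... | yes refl = ≤-refl
  ... | no t≢t   = ⊥-elim (t≢t refl)
  best-complete (suc k) done _ = lightest-within (candidates k t) (here refl) (best-complete k done z≤n)
  best-complete (suc k) (step {v = w} e free lk r) (s≤s r≤k) =
    lightest-within (candidates k _) (there (∈-map⁺ _ (∈-cartesianProduct⁺ (∈-allFin e) (∈-allFin w))))
                    (extendAcross-within k free lk (best-complete k r r≤k))

  nearest : (v : Fin n) → Maybe (Route v)
  nearest v = best n v

  nearest-complete : ∀ {v} (r : Route v) → Within (nearest v) (weight r)
  nearest-complete r =
    let (r′ , simple , r′≤r) = shortcut r
    in within-weaken (nearest _) (best-complete n r′ (<⇒≤ (simple-steps r′ simple))) r′≤r

  _⊑_ : ∀ {u v} → Maybe (Route u) → Maybe (Route v) → Set (c Level.⊔ ℓ)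
  a ⊑ b = ∀ {x} → Within b x → Within a x

  ⊑-total : ∀ {u v} (a : Maybe (Route u)) (b : Maybe (Route v)) → a ⊑ b ⊎ b ⊑ a
  ⊑-total a        nothing   = inj₁ λ ()
  ⊑-total nothing  (just r′) = inj₂ λ ()
  ⊑-total (just r) (just r′) with total (weight r) (weight r′)
  ... | inj₁ r≤r′ = inj₁ (≤-trans r≤r′)
  ... | inj₂ r′≤r = inj₂ (≤-trans r′≤r)

  outward : Fin n × Fin n → Bool
  outward (a , b) with ⊑-total (nearest a) (nearest b)
  ... | inj₁ _ = false
  ... | inj₂ _ = true

  away : Orientation m
  away e = outward (ends e)

  outward-false : ∀ {a b} → outward (a , b) ≡ false → nearest a ⊑ nearest b
  outward-false {a} {b} eq with ⊑-total (nearest a) (nearest b)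
  outward-false refl | inj₁ a⊑b = a⊑b

  outward-true : ∀ {a b} → outward (a , b) ≡ true → nearest b ⊑ nearest a
  outward-true {a} {b} eq with ⊑-total (nearest a) (nearest b)
  outward-true refl | inj₂ b⊑a = b⊑a

  away-arc : ∀ f e {u w} → f e ≡ away e → Arc G f e u w → nearest u ⊑ nearest w
  away-arc f e fe arc with f e
  ... | false rewrite arc = outward-false (sym fe)
  ... | true  rewrite arc = outward-true (sym fe)

  -- A directed walk to t in an orientation directing Y away from t yields
  -- a route in G - Y that is no heavier: steps along Y-edges are replaced
  -- by shortest routes, which are no heavier than the rest of the walk.
  routeOf : ∀ g {v} (P : Walk G (g ⋆[ Y ] away) v t) →
            Σ (Route v) λ r → weight r ≤ walkLength G R len P
  routeOf g [] = done , ≤-refl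
  routeOf g (step {v} {w} e arc P) = continue (Y e) refl (routeOf g P)
    where
    continue : ∀ b → Y e ≡ b → Σ (Route w) (λ r → weight r ≤ walkLength G R len P) →
               Σ (Route v) λ r → weight r ≤ len e + walkLength G R len P
    continue false free (r , r≤P) = step e free (arc-link (g ⋆[ Y ] away) e arc) r , +-monoʳ-≤ (len e) r≤P
    continue true onY (r , r≤P) =
      let v⊑w         = away-arc (g ⋆[ Y ] away) e (⋆-on {Y = Y} g away onY) arc
          (r′ , r′≤r) = fromWithin (nearest v) (v⊑w (nearest-complete r))
      in r′ , ≤-trans r′≤r (≤-trans r≤P (≤-+ˡ _ (nonneg e)))

  Follows : (Fin m → Bool) → ∀ {u} → Route u → Set
  Follows g done            = ⊤
  Follows g (step e _ lk r) = g e ≡ direction lk × Follows g r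

  follows-ext : ∀ g g′ {u} (r : Route u) → Follows g r →
                (∀ e → e ∈ edges r → g′ e ≡ g e) → Follows g′ r
  follows-ext g g′ done           _              _    = tt
  follows-ext g g′ (step e _ _ r) (ge , follows) same =
    trans (same e (here refl)) ge , follows-ext g g′ r follows λ e′ e′∈r → same e′ (there e′∈r)

  edge-ends : ∀ {e u} (r : Route u) → e ∈ edges r →
              ∃₂ λ x y → Link e x y × x ∈ vertices r × y ∈ vertices r
  edge-ends (step e _ lk r) (here refl) = _ , _ , lk , here refl , there (here refl)
  edge-ends (step _ _ _ r) (there e∈r) =
    let (x , y , lk , x∈r , y∈r) = edge-ends r e∈r in x , y , lk , there x∈r , there y∈r

  fresh-edge : ∀ {e u v} (r : Route v) → Link e u v → All (u ≢_) (vertices r) → e ∉ edges r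
  fresh-edge {e} {u} r lk u∉r e∈r with edge-ends r e∈r
  ... | x , y , lk′ , x∈r , y∈r = clash lk lk′
    where
    off : ∀ {z} → z ∈ vertices r → u ≢ z
    off z∈r = All.lookup u∉r z∈r
    clash : Link e u _ → Link e x y → ⊥
    clash (inj₁ p) (inj₁ q) = off x∈r (cong proj₁ (trans (sym p) q))
    clash (inj₁ p) (inj₂ q) = off y∈r (cong proj₁ (trans (sym p) q))
    clash (inj₂ p) (inj₁ q) = off y∈r (cong proj₂ (trans (sym p) q))
    clash (inj₂ p) (inj₂ q) = off x∈r (cong proj₂ (trans (sym p) q))

  orientationOf : ∀ {u} → Route u → Orientation m
  orientationOf done            e = false
  orientationOf (step e′ _ lk r) e with e ≟ e′
  ... | yes _ = direction lk
  ... | no _  = orientationOf r e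

  -- On a simple route no edge repeats, so this orientation follows it.
  follows-orientationOf : ∀ {u} (r : Route u) → Simple r → Follows (orientationOf r) r
  follows-orientationOf done _ = tt
  follows-orientationOf (step e free lk r) (u∉r ∷ simple) =
    head , follows-ext (orientationOf r) _ r (follows-orientationOf r simple) unchanged
    where
    head : orientationOf (step e free lk r) e ≡ direction lk
    head with e ≟ e
    ... | yes _  = refl
    ... | no e≢e = ⊥-elim (e≢e refl)
    unchanged : ∀ e′ → e′ ∈ edges r → orientationOf (step e free lk r) e′ ≡ orientationOf r e′
    unchanged e′ e′∈r with e′ ≟ e
    ... | yes refl = ⊥-elim (fresh-edge r lk u∉r e′∈r)
    ... | no _     = refl

  -- A route followed by g is a directed walk in g ⋆[ Y ] h for every h,
  -- since it avoids Y; it has the same vertices and edges.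
  toWalk : ∀ g h {u} (r : Route u) → Follows g r → Walk G (g ⋆[ Y ] h) u t
  toWalk g h done               _              = []
  toWalk g h (step e free lk r) (ge , follows) =
    step e (link-arc (g ⋆[ Y ] h) e lk (trans (⋆-off {Y = Y} g h free) ge)) (toWalk g h r follows)

  toWalk-vertices : ∀ g h {u} (r : Route u) (follows : Follows g r) →
                    walkVertices G (toWalk g h r follows) ≡ vertices r
  toWalk-vertices g h     done           _             = refl
  toWalk-vertices g h {u} (step _ _ _ r) (_ , follows) = cong (u ∷_) (toWalk-vertices g h r follows)

  toWalk-edges : ∀ g h {u} (r : Route u) (follows : Follows g r) →
                 walkEdges G (toWalk g h r follows) ≡ edges r
  toWalk-edges g h done           _             = refl
  toWalk-edges g h (step e _ _ r) (_ , follows) = cong (e ∷_) (toWalk-edges g h r follows)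

  route-path : ∀ {s} (r : Route s) → Simple r → ∀ {d} → weight r ≤ d →
               ∀ h → DistAtMost G R len (orientationOf r ⋆[ Y ] h) s t d
  route-path r simple r≤d h =
    let follows = follows-orientationOf r simple
        P       = toWalk (orientationOf r) h r follows
    in P , subst Unique (sym (toWalk-vertices _ h r follows)) simple
         , subst (λ es → foldr _+_ 0# (map len es) ≤ _) (sym (toWalk-edges _ h r follows)) r≤d

theorem4p7 : ∀ {c ℓ : Level} (R : OrderedAbelianGroup c ℓ) {n m : ℕ} (G : SimpleGraph n m)
             (len : Fin m → OrderedAbelianGroup.Carrier R)
             → (∀ e → OrderedAbelianGroup._≤_ R (OrderedAbelianGroup.0# R) (len e))
             → (s t : Fin n) (d : OrderedAbelianGroup.Carrier R)
             → ShatteringExtremal (λ f → DistAtMost G R len f s t d)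
theorem4p7 {ℓ = ℓ} R {m = m} G len nonneg s t d Y = mk⇔ shatters⇒strongly (strongly⇒shatters S Y)
  where
  open OrderFacts R using (≤-trans)
  open Routes R G len nonneg Y t
  S : Orientation m → Set ℓ
  S f = DistAtMost G R len f s t d
  shatters⇒strongly : Shatters S Y → StronglyShatters S Y
  shatters⇒strongly shattered =
    let (g , P , _ , P≤d)    = shattered away
        (r , r≤P)            = routeOf g P
        (r′ , simple , r′≤r) = shortcut r
    in orientationOf r′ , route-path r′ simple (≤-trans r′≤r (≤-trans r≤P P≤d))
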